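{- Let $(X,d)$ be a finite metric space, $r:X\to\mathbb{R}_{>0}$, $k$ an integer and $\alpha>0$. Suppose there exist $y_u\ge0$ ($u\in X$) with $\sum_{u\in X}y_u\le k$ and $\sum_{u\in X:\,d(u,v)\le\alpha r(v)}y_u\ge1$ for every $v\in X$. Then the Filter procedure run on $(X,d)$ with radius function $\alpha r$ and ordering $\phi(v)=1/r(v)$ outputs a set $S$ of at most $k$ points such that $d(v,S)\le 2\alpha\, r(v)$ for every $v\in X$.
   Context: Filter procedure: given a finite set $Y$ with metric $d$, radii $\tilde r$, and an ordering function $\phi:Y\to\mathbb{R}_{\ge0}$, set $U\leftarrow Y$, $S\leftarrow\emptyset$; while $U\neq\emptyset$, pick $u\in U$ maximizing $\phi(u)$ (ties arbitrary), add $u$ to $S$, let $D(u)=\{v\in U: d(u,v)\le \tilde r(u)+\tilde r(v)\}$, and set $U\leftarrow U\setminus D(u)$; output $S$. Here $d(v,S)=\min_{s\in S}d(v,s)$. -}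

module Defs where

open import Level using (0ℓ)
open import Data.Nat as ℕ using (ℕ; zero; suc)
open import Data.Integer as ℤ using (ℤ; +_; -[1+_])
open import Data.Fin using (Fin)
open import Data.List using (List; []; _∷_; filter; foldr; allFin)
open import Data.List.Membership.Propositional using (_∈_)
open import Relation.Binary.PropositionalEquality using (_≡_)
open import Relation.Nullary using (¬_; ¬?)
import Algebra.Structures as AS
import Relation.Binary.Structures as RS

-- An ordered field (the real numbers are one).  The theorem is stated for
-- an arbitrary ordered field, hence in particular for ℝ.
record OrderedField : Set₁ where
  infixl 6 _+_
  infixl 7 _*_
  infix 4 _≤_ _<_
  field
    F   : Set
    0# 1# : F
    _+_ _*_ : F → F → F
    -_  : F → F
    _⁻¹ : F → F
    _≤_ : F → F → Set
    isCommutativeRing : AS.IsCommutativeRing {A = F} _≡_ _+_ _*_ -_ 0# 1#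
    isDecTotalOrder   : RS.IsDecTotalOrder {A = F} _≡_ _≤_
    0≢1     : ¬ (0# ≡ 1#)
    ⁻¹-inverse : ∀ x → ¬ (x ≡ 0#) → x * (x ⁻¹) ≡ 1#
    +-monoˡ-≤ : ∀ {x y} z → x ≤ y → x + z ≤ y + z
    *-nonneg  : ∀ {x y} → 0# ≤ x → 0# ≤ y → 0# ≤ x * y

  _<_ : F → F → Set
  x < y = x ≤ y × ¬ (x ≡ y)
    where open import Data.Product using (_×_)

  open RS.IsDecTotalOrder isDecTotalOrder public using (_≤?_)

  sumL : {A : Set} → List A → (A → F) → F
  sumL xs f = foldr (λ a s → f a + s) 0# xs

  fromℕ : ℕ → F
  fromℕ zero    = 0#
  fromℕ (suc n) = 1# + fromℕ n

  fromℤ : ℤ → F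
  fromℤ (+ n)      = fromℕ n
  fromℤ -[1+ n ]   = - (fromℕ (suc n))

record IsMetric (K : OrderedField) (n : ℕ) (d : Fin n → Fin n → OrderedField.F K) : Set where
  open OrderedField K
  field
    nonneg   : ∀ x y → 0# ≤ d x y
    zero-iff : ∀ x y → d x y ≡ 0# → x ≡ y
    refl0    : ∀ x → d x x ≡ 0#
    sym      : ∀ x y → d x y ≡ d y x
    triangle : ∀ x y z → d x z ≤ d x y + d y z

-- The Filter procedure, as a relation between the current set U (a list of
-- points) and an output S: every admissible run (any tie-breaking) is captured.
module FilterProc (K : OrderedField) {n : ℕ}
                  (d : Fin n → Fin n → OrderedField.F K)
                  (rt φ : Fin n → OrderedField.F K) where
  open OrderedField K

  remove : Fin n → List (Fin n) → List (Fin n)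
  remove u U = filter (λ v → ¬? (d u v ≤? rt u + rt v)) U

  data FilterRun : List (Fin n) → List (Fin n) → Set where
    done : FilterRun [] []
    step : ∀ {U S} u → u ∈ U → (∀ w → w ∈ U → φ w ≤ φ u) →
           FilterRun (remove u U) S → FilterRun U (u ∷ S)

  Filter : List (Fin n) → List (Fin n) → Set
  Filter Y S = FilterRun Y S

-- A feasible y is a fractional cover of the balls B(v, α r v).  When Filter
-- selects s, every later survivor v is far from s, so by the triangle
-- inequality the balls B(s, α r s) of the selected points are pairwise
-- disjoint; each carries y-mass at least 1, hence |S| ≤ Σ y ≤ k.  A point v
-- removed by s satisfies d(v, s) ≤ α r s + α r v, and s has maximal 1/r,
-- i.e. minimal radius among the remaining points, so d(v, s) ≤ 2 α r v.

module Submission where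

open import Defs
open import Level using (0ℓ)
open import Data.Nat as ℕ using (ℕ; zero; suc; z≤n; s≤s)
open import Data.Integer as ℤ using (ℤ; +_)
open import Data.Fin using (Fin)
open import Data.List using (List; []; _∷_; length; filter; allFin)
open import Data.List.Relation.Unary.Any using (here; there)
open import Data.List.Membership.Propositional using (_∈_)
open import Data.List.Membership.Propositional.Properties using (∈-filter⁺; ∈-filter⁻; ∈-allFin)
open import Data.Product using (_×_; Σ-syntax; _,_; proj₁; proj₂)
open import Data.Sum using (inj₁; inj₂)
open import Data.Bool using (if_then_else_)
open import Data.Empty using (⊥-elim)
open import Relation.Nullary using (¬_; ¬?; yes; no; does)
open import Relation.Unary using (Pred; Decidable)
open import Relation.Binary.PropositionalEquality using (_≡_; refl; sym; cong; cong₂)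
open import Relation.Binary.Bundles using (Poset)
import Algebra.Structures as AS
import Algebra.Bundles as AB
import Algebra.Properties.Ring as RingProperties
import Relation.Binary.Structures as RS
import Relation.Binary.Reasoning.PartialOrder as ≤-Reasoning

module OrderedFieldProperties (K : OrderedField) where
  open OrderedField K
  open AS.IsCommutativeRing isCommutativeRing
    using (+-assoc; +-comm; +-identityˡ; +-identityʳ; -‿inverseʳ;
           *-assoc; *-comm; *-identityˡ; distribʳ)
  open RS.IsDecTotalOrder isDecTotalOrder using (trans; antisym; total)
  open RS.IsDecTotalOrder isDecTotalOrder public using () renaming (refl to ≤-refl)

  commutativeRing : AB.CommutativeRing _ _
  commutativeRing = record { isCommutativeRing = isCommutativeRing }

  open RingProperties (AB.CommutativeRing.ring commutativeRing)
    using (-1*x≈-x; -‿involutive; -‿distribˡ-*)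

  poset : Poset _ _ _
  poset = record { isPartialOrder = RS.IsDecTotalOrder.isPartialOrder isDecTotalOrder }

  open ≤-Reasoning poset

  +-monoʳ-≤ : ∀ {x y} z → x ≤ y → z + x ≤ z + y
  +-monoʳ-≤ {x} {y} z x≤y = begin
    z + x  ≡⟨ +-comm z x ⟩
    x + z  ≤⟨ +-monoˡ-≤ z x≤y ⟩
    y + z  ≡⟨ +-comm y z ⟩
    z + y  ∎

  +-mono-≤ : ∀ {a b c d} → a ≤ b → c ≤ d → a + c ≤ b + d
  +-mono-≤ {b = b} {c = c} a≤b c≤d = trans (+-monoˡ-≤ c a≤b) (+-monoʳ-≤ b c≤d)

  +-nonneg : ∀ {a b} → 0# ≤ a → 0# ≤ b → 0# ≤ a + b
  +-nonneg 0≤a 0≤b = begin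
    0#       ≡⟨ +-identityˡ 0# ⟨
    0# + 0#  ≤⟨ +-mono-≤ 0≤a 0≤b ⟩
    _ + _    ∎

  x+z+-z≡x : ∀ x z → x + z + - z ≡ x
  x+z+-z≡x x z = begin-equality
    x + z + - z    ≡⟨ +-assoc x z (- z) ⟩
    x + (z + - z)  ≡⟨ cong (_+_ x) (-‿inverseʳ z) ⟩
    x + 0#         ≡⟨ +-identityʳ x ⟩
    x              ∎

  +-cancelʳ-≤ : ∀ {x y} z → x + z ≤ y + z → x ≤ y
  +-cancelʳ-≤ {x} {y} z p = begin
    x            ≡⟨ x+z+-z≡x x z ⟨
    x + z + - z  ≤⟨ +-monoˡ-≤ (- z) p ⟩
    y + z + - z  ≡⟨ x+z+-z≡x y z ⟩
    y            ∎

  +-cancelˡ-≤ : ∀ {x y} z → z + x ≤ z + y → x ≤ y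
  +-cancelˡ-≤ {x} {y} z p = +-cancelʳ-≤ z (begin
    x + z  ≡⟨ +-comm x z ⟩
    z + x  ≤⟨ p ⟩
    z + y  ≡⟨ +-comm z y ⟩
    y + z  ∎)

  x≤y⇒0≤y-x : ∀ {x y} → x ≤ y → 0# ≤ y + - x
  x≤y⇒0≤y-x {x} {y} x≤y = begin
    0#      ≡⟨ -‿inverseʳ x ⟨
    x + - x ≤⟨ +-monoˡ-≤ (- x) x≤y ⟩
    y + - x ∎

  0≤y-x⇒x≤y : ∀ {x y} → 0# ≤ y + - x → x ≤ y
  0≤y-x⇒x≤y {x} {y} p = +-cancelʳ-≤ (- x) (begin
    x + - x  ≡⟨ -‿inverseʳ x ⟩
    0#       ≤⟨ p ⟩
    y + - x  ∎)

  -- If 1 ≤ 0 then 0 ≤ -1, and so 0 ≤ (-1)(-1) = 1.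
  0≤1 : 0# ≤ 1#
  0≤1 with total 0# 1#
  ... | inj₁ 0≤1 = 0≤1
  ... | inj₂ 1≤0 = ⊥-elim (0≢1 (antisym 0≤1′ 1≤0))
    where
    0≤-1 : 0# ≤ - 1#
    0≤-1 = begin
      0#         ≤⟨ x≤y⇒0≤y-x 1≤0 ⟩
      0# + - 1#  ≡⟨ +-identityˡ (- 1#) ⟩
      - 1#       ∎
    0≤1′ : 0# ≤ 1#
    0≤1′ = begin
      0#             ≤⟨ *-nonneg 0≤-1 0≤-1 ⟩
      - 1# * - 1#    ≡⟨ -1*x≈-x (- 1#) ⟩
      - - 1#         ≡⟨ -‿involutive 1# ⟩
      1#             ∎

  x≥0⇒1+x≰0 : ∀ {x} → 0# ≤ x → ¬ (1# + x ≤ 0#)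
  x≥0⇒1+x≰0 {x} 0≤x 1+x≤0 = 0≢1 (antisym 0≤1 (begin
    1#       ≡⟨ +-identityʳ 1# ⟨
    1# + 0#  ≤⟨ +-monoʳ-≤ 1# 0≤x ⟩
    1# + x   ≤⟨ 1+x≤0 ⟩
    0#       ∎))

  fromℕ-nonneg : ∀ m → 0# ≤ fromℕ m
  fromℕ-nonneg zero    = ≤-refl
  fromℕ-nonneg (suc m) = +-nonneg 0≤1 (fromℕ-nonneg m)

  fromℕ-cancel-≤ : ∀ a m → fromℕ a ≤ fromℕ m → a ℕ.≤ m
  fromℕ-cancel-≤ zero    m       p = z≤n
  fromℕ-cancel-≤ (suc a) zero    p = ⊥-elim (x≥0⇒1+x≰0 (fromℕ-nonneg a) p)
  fromℕ-cancel-≤ (suc a) (suc m) p = s≤s (fromℕ-cancel-≤ a m (+-cancelˡ-≤ 1# p))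

  fromℕ≤fromℤ⇒≤ : ∀ a k → fromℕ a ≤ fromℤ k → + a ℤ.≤ k
  fromℕ≤fromℤ⇒≤ a (+ m)       p = ℤ.+≤+ (fromℕ-cancel-≤ a m p)
  fromℕ≤fromℤ⇒≤ a ℤ.-[1+ m ] p = ⊥-elim (x≥0⇒1+x≰0 (fromℕ-nonneg m) (0≤y-x⇒x≤y (begin
    0#             ≤⟨ trans (fromℕ-nonneg a) p ⟩
    - x            ≡⟨ +-identityˡ (- x) ⟨
    0# + - x       ∎)))
    where x = 1# + fromℕ m

  *-monoˡ-≤-nonneg : ∀ {a b} c → 0# ≤ c → a ≤ b → a * c ≤ b * c
  *-monoˡ-≤-nonneg {a} {b} c 0≤c a≤b = 0≤y-x⇒x≤y (begin
    0#                  ≤⟨ *-nonneg (x≤y⇒0≤y-x a≤b) 0≤c ⟩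
    (b + - a) * c       ≡⟨ distribʳ c b (- a) ⟩
    b * c + - a * c     ≡⟨ cong (_+_ (b * c)) (-‿distribˡ-* a c) ⟨
    b * c + - (a * c)   ∎)

  *-monoʳ-≤-nonneg : ∀ {a b} c → 0# ≤ c → a ≤ b → c * a ≤ c * b
  *-monoʳ-≤-nonneg {a} {b} c 0≤c a≤b = begin
    c * a  ≡⟨ *-comm c a ⟩
    a * c  ≤⟨ *-monoˡ-≤-nonneg c 0≤c a≤b ⟩
    b * c  ≡⟨ *-comm b c ⟩
    c * b  ∎

  >0⇒≢0 : ∀ {x} → 0# < x → ¬ (x ≡ 0#)
  >0⇒≢0 (_ , 0≢x) x≡0 = 0≢x (sym x≡0)

  x⁻¹*[x*y]≡y : ∀ {x} → 0# < x → ∀ y → x ⁻¹ * (x * y) ≡ y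
  x⁻¹*[x*y]≡y {x} 0<x y = begin-equality
    x ⁻¹ * (x * y)  ≡⟨ *-assoc (x ⁻¹) x y ⟨
    x ⁻¹ * x * y    ≡⟨ cong (_* y) (*-comm (x ⁻¹) x) ⟩
    x * x ⁻¹ * y    ≡⟨ cong (_* y) (⁻¹-inverse x (>0⇒≢0 0<x)) ⟩
    1# * y          ≡⟨ *-identityˡ y ⟩
    y               ∎

  ⁻¹-cancel-≤ : ∀ {a b} → 0# < a → 0# < b → b ⁻¹ ≤ a ⁻¹ → a ≤ b
  ⁻¹-cancel-≤ {a} {b} 0<a 0<b p = begin
    a               ≡⟨ x⁻¹*[x*y]≡y 0<b a ⟨
    b ⁻¹ * (b * a)  ≡⟨ cong (b ⁻¹ *_) (*-comm b a) ⟩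
    b ⁻¹ * (a * b)  ≤⟨ *-monoˡ-≤-nonneg (a * b) (*-nonneg (proj₁ 0<a) (proj₁ 0<b)) p ⟩
    a ⁻¹ * (a * b)  ≡⟨ x⁻¹*[x*y]≡y 0<a b ⟩
    b               ∎

  [1+1]*x*y≡x*y+x*y : ∀ x y → (1# + 1#) * x * y ≡ x * y + x * y
  [1+1]*x*y≡x*y+x*y x y = begin-equality
    (1# + 1#) * x * y              ≡⟨ *-assoc (1# + 1#) x y ⟩
    (1# + 1#) * (x * y)            ≡⟨ distribʳ (x * y) 1# 1# ⟩
    1# * (x * y) + 1# * (x * y)    ≡⟨ cong₂ _+_ (*-identityˡ _) (*-identityˡ _) ⟩
    x * y + x * y                  ∎

module Sums (K : OrderedField) where
  open OrderedField K
  open OrderedFieldProperties K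
  open AS.IsCommutativeRing isCommutativeRing using (+-assoc; +-comm; +-identityˡ)
  open ≤-Reasoning poset using (begin-equality_; step-≡-⟩; step-≡-⟨; _∎)

  sumL-nonneg : ∀ {A : Set} (xs : List A) (w : A → F) → (∀ a → 0# ≤ w a) → 0# ≤ sumL xs w
  sumL-nonneg []       w 0≤w = ≤-refl
  sumL-nonneg (x ∷ xs) w 0≤w = +-nonneg (0≤w x) (sumL-nonneg xs w 0≤w)

  module _ {A : Set} {P : Pred A 0ℓ} (P? : Decidable P) where

    zeroOn : (A → F) → A → F
    zeroOn w a = if does (P? a) then 0# else w a

    zeroOn-nonneg : ∀ w → (∀ a → 0# ≤ w a) → ∀ a → 0# ≤ zeroOn w a
    zeroOn-nonneg w 0≤w a with P? a
    ... | yes _ = ≤-refl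
    ... | no  _ = 0≤w a

    sumL-filter-cong : ∀ xs {w w′ : A → F} → (∀ a → P a → w a ≡ w′ a) →
                       sumL (filter P? xs) w ≡ sumL (filter P? xs) w′
    sumL-filter-cong []       w≡w′ = refl
    sumL-filter-cong (x ∷ xs) w≡w′ with P? x
    ... | yes Px = cong₂ _+_ (w≡w′ x Px) (sumL-filter-cong xs w≡w′)
    ... | no  _  = sumL-filter-cong xs w≡w′

    sumL-split : ∀ xs w → sumL xs w ≡ sumL xs (zeroOn w) + sumL (filter P? xs) w
    sumL-split []       w = sym (+-identityˡ 0#)
    sumL-split (x ∷ xs) w with P? x
    ... | yes _ = begin-equality
      w x + sumL xs w      ≡⟨ cong (_+_ (w x)) (sumL-split xs w) ⟩
      w x + (Z + Q)        ≡⟨ +-assoc (w x) Z Q ⟨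
      w x + Z + Q          ≡⟨ cong (_+ Q) (+-comm (w x) Z) ⟩
      Z + w x + Q          ≡⟨ +-assoc Z (w x) Q ⟩
      Z + (w x + Q)        ≡⟨ cong (_+ (w x + Q)) (+-identityˡ Z) ⟨
      0# + Z + (w x + Q)   ∎
      where Z = sumL xs (zeroOn w); Q = sumL (filter P? xs) w
    ... | no _ = begin-equality
      w x + sumL xs w      ≡⟨ cong (_+_ (w x)) (sumL-split xs w) ⟩
      w x + (Z + Q)        ≡⟨ +-assoc (w x) Z Q ⟨
      w x + Z + Q          ∎
      where Z = sumL xs (zeroOn w); Q = sumL (filter P? xs) w

module FilterProperties (K : OrderedField) {n : ℕ} {d : Fin n → Fin n → OrderedField.F K}
                        (metric : IsMetric K n d) (rt φ : Fin n → OrderedField.F K) where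
  open OrderedField K
  open OrderedFieldProperties K
  open Sums K
  open FilterProc K d rt φ
  open IsMetric metric using (triangle) renaming (sym to d-sym)
  open RS.IsDecTotalOrder isDecTotalOrder using (trans)
  open AS.IsCommutativeRing isCommutativeRing using (+-comm)
  open ≤-Reasoning poset

  Far : Fin n → Fin n → Set
  Far u v = ¬ (d u v ≤ rt u + rt v)

  ∈-remove⁻ : ∀ {u v U} → v ∈ remove u U → v ∈ U × Far u v
  ∈-remove⁻ = ∈-filter⁻ (λ v → ¬? (d _ v ≤? rt _ + rt v))

  ∈-remove⁺ : ∀ {u v U} → v ∈ U → Far u v → v ∈ remove u U
  ∈-remove⁺ = ∈-filter⁺ (λ v → ¬? (d _ v ≤? rt _ + rt v))

  FilterRun-covers : (∀ u w → φ w ≤ φ u → rt u ≤ rt w) →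
                     ∀ {U S} → FilterRun U S →
                     ∀ v → v ∈ U → Σ[ s ∈ Fin n ] (s ∈ S × d v s ≤ rt v + rt v)
  FilterRun-covers rt-anti (step s s∈U φ-max run) v v∈U with d s v ≤? rt s + rt v
  ... | yes near = s , here refl , (begin
    d v s          ≡⟨ d-sym v s ⟩
    d s v          ≤⟨ near ⟩
    rt s + rt v    ≤⟨ +-monoˡ-≤ (rt v) (rt-anti s v (φ-max v v∈U)) ⟩
    rt v + rt v    ∎)
  ... | no far with FilterRun-covers rt-anti run v (∈-remove⁺ v∈U far)
  ...   | s′ , s′∈S , close = s′ , there s′∈S , close

  ball-disjoint-remove : ∀ {s v U u} → v ∈ remove s U → d u s ≤ rt s → ¬ (d u v ≤ rt v)
  ball-disjoint-remove {s} {v} {U} {u} v∈ u∈Bs u∈Bv = proj₂ (∈-remove⁻ {U = U} v∈) (begin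
    d s v          ≤⟨ triangle s u v ⟩
    d s u + d u v  ≡⟨ cong (_+ d u v) (d-sym s u) ⟩
    d u s + d u v  ≤⟨ +-mono-≤ u∈Bs u∈Bv ⟩
    rt s + rt v    ∎)

  AgreesOnBalls : List (Fin n) → (w y : Fin n → F) → Set
  AgreesOnBalls U w y = ∀ s → s ∈ U → ∀ u → d u s ≤ rt s → w u ≡ y u

  -- w is y with the balls of the already selected points zeroed out; these
  -- balls are disjoint from the balls of the points still in U.
  FilterRun-length : (y : Fin n → F) →
                     (∀ s → 1# ≤ sumL (filter (λ u → d u s ≤? rt s) (allFin n)) y) →
                     ∀ {U S} → FilterRun U S →
                     (w : Fin n → F) → (∀ u → 0# ≤ w u) → AgreesOnBalls U w y →
                     fromℕ (length S) ≤ sumL (allFin n) w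
  FilterRun-length y mass done w 0≤w agree = sumL-nonneg (allFin n) w 0≤w
  FilterRun-length y mass {U} (step {S = S} s s∈U φ-max run) w 0≤w agree = begin
    1# + fromℕ (length S)             ≤⟨ +-monoʳ-≤ 1# rest ⟩
    1# + sumL (allFin n) w′           ≡⟨ +-comm 1# _ ⟩
    sumL (allFin n) w′ + 1#           ≤⟨ +-monoʳ-≤ _ (mass s) ⟩
    sumL (allFin n) w′ + sumL ball y  ≡⟨ cong (_+_ _) (sumL-filter-cong inBall? (allFin n) (agree s s∈U)) ⟨
    sumL (allFin n) w′ + sumL ball w  ≡⟨ sumL-split inBall? (allFin n) w ⟨
    sumL (allFin n) w                 ∎
    where
    inBall? = λ u → d u s ≤? rt s
    ball = filter inBall? (allFin n)
    w′ = zeroOn inBall? w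
    agree′ : AgreesOnBalls (remove s U) w′ y
    agree′ v v∈ u u∈Bv with inBall? u
    ... | yes u∈Bs = ⊥-elim (ball-disjoint-remove {U = U} v∈ u∈Bs u∈Bv)
    ... | no  _    = agree v (proj₁ (∈-remove⁻ {U = U} v∈)) u u∈Bv
    rest : fromℕ (length S) ≤ sumL (allFin n) w′
    rest = FilterRun-length y mass run w′ (zeroOn-nonneg inBall? w 0≤w) agree′

claim6p1 : (K : OrderedField) → let open OrderedField K in
    (n : ℕ) (d : Fin n → Fin n → F) → IsMetric K n d →
    (r : Fin n → F) → (∀ v → 0# < r v) →
    (k : ℤ) (α : F) → 0# < α →
    (y : Fin n → F) → (∀ u → 0# ≤ y u) →
    sumL (allFin n) y ≤ fromℤ k →
    (∀ v → 1# ≤ sumL (filter (λ u → d u v ≤? α * r v) (allFin n)) y) →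
    (S : List (Fin n)) →
    FilterProc.Filter K d (λ v → α * r v) (λ v → r v ⁻¹) (allFin n) S →
    (+ length S ℤ.≤ k) ×
    (∀ v → Σ[ s ∈ Fin n ] (s ∈ S × d v s ≤ (1# + 1#) * α * r v))
claim6p1 K n d metric r 0<r k α 0<α y 0≤y Σy≤k mass S run =
  fromℕ≤fromℤ⇒≤ (length S) k (trans (FilterRun-length y mass run y 0≤y (λ _ _ _ _ → refl)) Σy≤k) ,
  covered
  where
  open OrderedField K
  open OrderedFieldProperties K
  open FilterProperties K metric (λ v → α * r v) (λ v → r v ⁻¹)
  open RS.IsDecTotalOrder isDecTotalOrder using (trans)
  open ≤-Reasoning poset

  αr-anti : ∀ u w → r w ⁻¹ ≤ r u ⁻¹ → α * r u ≤ α * r w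
  αr-anti u w r⁻¹≤ = *-monoʳ-≤-nonneg α (proj₁ 0<α) (⁻¹-cancel-≤ (0<r u) (0<r w) r⁻¹≤)

  covered : ∀ v → Σ[ s ∈ Fin n ] (s ∈ S × d v s ≤ (1# + 1#) * α * r v)
  covered v with FilterRun-covers αr-anti run v (∈-allFin v)
  ... | s , s∈S , close = s , s∈S , (begin
    d v s                ≤⟨ close ⟩
    α * r v + α * r v    ≡⟨ [1+1]*x*y≡x*y+x*y α (r v) ⟨
    (1# + 1#) * α * r v  ∎)
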